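{- Let $\beta\ge3$ be an integer, let $(G=(A,B,E),\{A_i\},\{B_i\})$ be a Min-Rep instance and let $G'$ be the directed graph constructed from it as described in the context. If $S$ is a shortcut set of $G'$ with hopbound $\beta$ and size $\gamma$, then there is a canonical shortcut set $S'$ of $G'$ with hopbound $\beta$ and size at most $2\gamma$.
   Context: Min-Rep instance: an undirected bipartite graph $G=(A,B,E)$ with partitions $A=A_1\cup\dots\cup A_m$ and $B=B_1\cup\dots\cup B_m$ into groups, all of the same size; $(i,j)$ is a superedge if some edge joins $A_i$ and $B_j$. Construction of $G'=(V',E')$: add new vertices $a_i^1,a_i^2,b_i^1,b_i^2$ for $i\in[m]$, and for each $e=\{a,b\}\in E$ ($a\in A$, $b\in B$) new vertices $v_e^1,\dots,v_e^{\beta-3}$ (none if $\beta=3$); $V'$ is $A\cup B$ together with all these. Directed edges: for each $e=\{a,b\}$ the path $P_e$ consisting of $(a,v_e^1)$, $(v_e^i,v_e^{i+1})$ for $i\in[\beta-4]$, and $(v_e^{\beta-3},b)$ (if $\beta=3$, $P_e=\{(a,b)\}$); plus $(a_i^1,a_i^2)$ and $(b_i^2,b_i^1)$ for $i\in[m]$; plus $(a_i^2,x)$ for $x\in A_i$ and $(x,b_i^2)$ for $x\in B_i$. A shortcut set with hopbound $\beta$ for $G'$ is a set of directed edges $(x,y)$ with $y$ reachable from $x$ in $G'$ such that for every pair $x,y$ with $y$ reachable from $x$, the graph obtained by adding the set to $G'$ has an $x$–$y$ path with at most $\beta$ edges. A shortcut edge is canonical if it is of the form $(a_i^1,a)$ with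 $a\in A_i$ or $(b,b_i^1)$ with $b\in B_i$ for some $i\in[m]$; a shortcut set is canonical if all its edges are canonical. -}

module Defs where

open import Data.Nat using (ℕ; zero; suc; _∸_; _≤_)
open import Data.Fin using (Fin; toℕ)
open import Data.Bool using (Bool; T)
open import Data.Product using (_×_; _,_; ∃; ∃-syntax)
open import Data.Sum using (_⊎_)
open import Data.List using (List)
open import Data.List.Membership.Propositional using (_∈_)
open import Data.List.Relation.Unary.All using (All)
open import Relation.Binary.PropositionalEquality using (_≡_)

-- Min-Rep instance: m groups on each side, every group of size k.
-- A = B = Fin m × Fin k, where (i , x) is the x-th vertex of group A_i (resp. B_i).
-- The edge set E ⊆ A × B is given by its (Boolean) indicator:
-- E i x j y = true  iff  {(i,x) ∈ A , (j,y) ∈ B} is an edge.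
MinRepEdges : ℕ → ℕ → Set
MinRepEdges m k = Fin m → Fin k → Fin m → Fin k → Bool

module Construction (β m k : ℕ) (E : MinRepEdges m k) where

  data V : Set where
    vA  : Fin m → Fin k → V
    vB  : Fin m → Fin k → V
    a¹ a² b¹ b² : Fin m → V
    -- v_e^{t+1} for e = {(i,x),(j,y)} ∈ E, t < β - 3
    vE  : (i : Fin m) (x : Fin k) (j : Fin m) (y : Fin k) →
          T (E i x j y) → Fin (β ∸ 3) → V

  data Arc : V → V → Set where
    pDirect : ∀ {i x j y} → β ∸ 3 ≡ 0 → (e : T (E i x j y)) →
              Arc (vA i x) (vB j y)
    pStart  : ∀ {i x j y} (e : T (E i x j y)) (t : Fin (β ∸ 3)) → toℕ t ≡ 0 →
              Arc (vA i x) (vE i x j y e t)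
    pMid    : ∀ {i x j y} (e : T (E i x j y)) (t t' : Fin (β ∸ 3)) →
              toℕ t' ≡ suc (toℕ t) →
              Arc (vE i x j y e t) (vE i x j y e t')
    pEnd    : ∀ {i x j y} (e : T (E i x j y)) (t : Fin (β ∸ 3)) →
              suc (toℕ t) ≡ β ∸ 3 →
              Arc (vE i x j y e t) (vB j y)
    a¹a² : ∀ i → Arc (a¹ i) (a² i)
    b²b¹ : ∀ i → Arc (b² i) (b¹ i)
    a²A  : ∀ i x → Arc (a² i) (vA i x)
    Bb²  : ∀ i y → Arc (vB i y) (b² i)

  data Walk (R : V → V → Set) : ℕ → V → V → Set where
    nil  : ∀ {x} → Walk R 0 x x
    cons : ∀ {n x y z} → R x y → Walk R n y z → Walk R (suc n) x z

  Reachable : V → V → Set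
  Reachable x y = ∃[ n ] Walk Arc n x y

  WithShortcuts : List (V × V) → V → V → Set
  WithShortcuts S x y = Arc x y ⊎ (x , y) ∈ S

  IsShortcutSet : List (V × V) → Set
  IsShortcutSet S =
    All (λ p → Reachable (Data.Product.proj₁ p) (Data.Product.proj₂ p)) S ×
    (∀ x y → Reachable x y → ∃[ n ] (n ≤ β × Walk (WithShortcuts S) n x y))

  data CanonicalEdge : V × V → Set where
    canA : ∀ i x → CanonicalEdge (a¹ i , vA i x)
    canB : ∀ i y → CanonicalEdge (vB i y , b¹ i)

  IsCanonical : List (V × V) → Set
  IsCanonical S = All CanonicalEdge S

-- G' is layered: every arc raises the level by one, from level 0 at a¹ᵢ to level β + 2
-- at b¹ⱼ.  So a walk longer than β can only join a¹ᵢ or a²ᵢ to b²ⱼ or b¹ⱼ, and then it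
-- runs through the path P_e of an edge e = {a , b} with a ∈ Aᵢ, b ∈ Bⱼ; given the two
-- canonical shortcuts (a¹ᵢ , a) and (b , b¹ⱼ) it is replaced by a route of β hops.
-- Replace every shortcut (x , y) ∈ S as follows.  If x ⇝ y crosses some P_e, put in both
-- canonical shortcuts of e; if (x , y) is canonical, keep it; otherwise x ⇝ y has at
-- most one arc and needs no shortcut at all.  A walk of at most β hops in G' ∪ S then
-- either uses a crossing shortcut, whose edge yields the route above, or translates hop
-- by hop into a walk of G' ∪ S' that is no longer.
module Submission where

open import Defs
open import Data.Nat using (ℕ; zero; suc; _+_; _∸_; _*_; _≤_; _<_; z≤n; s≤s; z<s; _≤?_)
open import Data.Nat.Properties
open import Data.Fin using (Fin; toℕ; fromℕ<)
open import Data.Fin.Properties using (toℕ<n; toℕ-fromℕ<)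
import Data.Fin.Properties as Fin
open import Data.Bool using (T)
open import Data.Maybe using (Maybe; just; nothing)
open import Data.Product using (Σ; _×_; _,_; proj₁; proj₂; uncurry; ∃-syntax)
import Data.Product.Properties as Product
open import Data.Sum using (_⊎_; inj₁; inj₂)
import Data.Sum.Properties as Sum
open import Data.List using (List; []; _∷_; _++_; map; length; deduplicate)
open import Data.List.Properties using (length-++; length-map; length-deduplicate)
open import Data.List.Membership.Propositional using (_∈_)
open import Data.List.Membership.Propositional.Properties
  using (∈-++⁺ˡ; ∈-++⁺ʳ; ∈-map⁺; ∈-deduplicate⁺)
open import Data.List.Relation.Unary.Any using (here; there)
open import Data.List.Relation.Unary.All using (All; []; _∷_; lookup; universal)
import Data.List.Relation.Unary.All.Properties as All
open import Data.List.Relation.Unary.Unique.Propositional using (Unique)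
import Data.List.Relation.Unary.Unique.Propositional.Properties as Unique
import Data.List.Relation.Unary.Unique.DecPropositional.Properties as UniqueDec
open import Data.Empty using (⊥-elim)
open import Relation.Binary.Definitions using (DecidableEquality)
open import Relation.Binary.PropositionalEquality
  using (_≡_; refl; sym; trans; cong; subst; module ≡-Reasoning)
open import Relation.Nullary using (yes; no)

module Reduction (β m k : ℕ) (E : MinRepEdges m k) where
  open Construction β m k E

  _++ᵂ_ : ∀ {R n n' x y z} → Walk R n x y → Walk R n' y z → Walk R (n + n') x z
  nil      ++ᵂ w' = w'
  cons r w ++ᵂ w' = cons r (w ++ᵂ w')

  mapᵂ : ∀ {R R' n x y} → (∀ {u v} → R u v → R' u v) → Walk R n x y → Walk R' n x y
  mapᵂ f nil        = nil
  mapᵂ f (cons r w) = cons (f r) (mapᵂ f w)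

  walk-backward : ∀ {R} {Q : V → Set} → (∀ {u v} → R u v → Q v → Q u) →
                  ∀ {n x y} → Walk R n x y → Q y → Q x
  walk-backward f nil        q = q
  walk-backward f (cons r w) q = f r (walk-backward f w q)

  walk-forward : ∀ {R} {Q : V → Set} → (∀ {u v} → R u v → Q u → Q v) →
                 ∀ {n x y} → Walk R n x y → Q x → Q y
  walk-forward f nil        q = q
  walk-forward f (cons r w) q = walk-forward f w (f r q)

  reachable-trans : ∀ {x y z} → Reachable x y → Reachable y z → Reachable x z
  reachable-trans (n , w) (n' , w') = n + n' , w ++ᵂ w'

  reachable-walk : ∀ {R n x y} → (∀ {u v} → R u v → Reachable u v) →
                   Walk R n x y → Reachable x y
  reachable-walk f nil        = 0 , nil
  reachable-walk f (cons r w) = reachable-trans (f r) (reachable-walk f w)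

  Hops : List (V × V) → ℕ → V → V → Set
  Hops T n x y = ∃[ h ] (h ≤ n × Walk (WithShortcuts T) h x y)

  liftᵂ : ∀ {T n x y} → Walk Arc n x y → Walk (WithShortcuts T) n x y
  liftᵂ = mapᵂ inj₁

  level : V → ℕ
  level (a¹ _)           = 0
  level (a² _)           = 1
  level (vA _ _)         = 2
  level (vE _ _ _ _ _ t) = 3 + toℕ t
  level (vB _ _)         = 3 + (β ∸ 3)
  level (b² _)           = 4 + (β ∸ 3)
  level (b¹ _)           = 5 + (β ∸ 3)

  level-arc : ∀ {x y} → Arc x y → level y ≡ suc (level x)
  level-arc (pDirect p _)  = cong (3 +_) p
  level-arc (pStart _ _ p) = cong (3 +_) p
  level-arc (pMid _ _ _ p) = cong (3 +_) p
  level-arc (pEnd _ _ p)   = cong (3 +_) (sym p)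
  level-arc (a¹a² _)       = refl
  level-arc (b²b¹ _)       = refl
  level-arc (a²A _ _)      = refl
  level-arc (Bb² _ _)      = refl

  level-walk : ∀ {n x y} → Walk Arc n x y → level y ≡ n + level x
  level-walk nil = refl
  level-walk {suc n} {x} {y} (cons {y = z} arc w) = begin
    level y               ≡⟨ level-walk w ⟩
    n + level z           ≡⟨ cong (n +_) (level-arc arc) ⟩
    n + suc (level x)     ≡⟨ +-suc n (level x) ⟩
    suc (n + level x)     ∎
    where open ≡-Reasoning

  level-≤ : ∀ v → level v ≤ 5 + (β ∸ 3)
  level-≤ (a¹ _)           = z≤n
  level-≤ (a² _)           = s≤s z≤n
  level-≤ (vA _ _)         = s≤s (s≤s z≤n)
  level-≤ (vE _ _ _ _ _ t) = +-monoʳ-≤ 3 (≤-trans (<⇒≤ (toℕ<n t)) (m≤n+m _ 2))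
  level-≤ (vB _ _)         = ≤-trans (n≤1+n _) (n≤1+n _)
  level-≤ (b² _)           = n≤1+n _
  level-≤ (b¹ _)           = ≤-refl

  long-walk-ends : 3 ≤ β → ∀ {n x y} → Walk Arc n x y → β < n →
                   level x ≤ 1 × 4 + (β ∸ 3) ≤ level y
  long-walk-ends 3≤β {n} {x} {y} w β<n = x≤1 , y-high
    where
    open ≤-Reasoning
    long : 4 + (β ∸ 3) ≤ n
    long = subst (_< n) (sym (m+[n∸m]≡n 3≤β)) β<n
    y-high : 4 + (β ∸ 3) ≤ level y
    y-high = begin
      4 + (β ∸ 3)  ≤⟨ long ⟩
      n            ≤⟨ m≤m+n n (level x) ⟩
      n + level x  ≡⟨ level-walk w ⟨
      level y      ∎
    x≤1 : level x ≤ 1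
    x≤1 = +-cancelˡ-≤ (4 + (β ∸ 3)) (level x) 1 (begin
      4 + (β ∸ 3) + level x  ≤⟨ +-monoˡ-≤ (level x) long ⟩
      n + level x            ≡⟨ level-walk w ⟨
      level y                ≤⟨ level-≤ y ⟩
      5 + (β ∸ 3)            ≡⟨ +-comm 1 (4 + (β ∸ 3)) ⟩
      4 + (β ∸ 3) + 1        ∎)

  groupA : V → Maybe (Fin m)
  groupA (a¹ i)           = just i
  groupA (a² i)           = just i
  groupA (vA i _)         = just i
  groupA (vE i _ _ _ _ _) = just i
  groupA _                = nothing

  groupB : V → Maybe (Fin m)
  groupB (vE _ _ j _ _ _) = just j
  groupB (vB j _)         = just j
  groupB (b² j)           = just j
  groupB (b¹ j)           = just j
  groupB _                = nothing

  groupA-arc : ∀ {i x y} → Arc x y → groupA y ≡ just i → groupA x ≡ just i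
  groupA-arc (pDirect _ _)  ()
  groupA-arc (pStart _ _ _) g = g
  groupA-arc (pMid _ _ _ _) g = g
  groupA-arc (pEnd _ _ _)   ()
  groupA-arc (a¹a² _)       g = g
  groupA-arc (b²b¹ _)       ()
  groupA-arc (a²A _ _)      g = g
  groupA-arc (Bb² _ _)      ()

  groupB-arc : ∀ {j x y} → Arc x y → groupB x ≡ just j → groupB y ≡ just j
  groupB-arc (pDirect _ _)  ()
  groupB-arc (pStart _ _ _) ()
  groupB-arc (pMid _ _ _ _) g = g
  groupB-arc (pEnd _ _ _)   g = g
  groupB-arc (a¹a² _)       ()
  groupB-arc (b²b¹ _)       g = g
  groupB-arc (a²A _ _)      ()
  groupB-arc (Bb² _ _)      g = g

  -- x lies before, and y after, the path P_e of the edge e = {(i , a) , (j , b)}.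
  record Crossing (x y : V) : Set where
    constructor crossing
    field
      {i j} : Fin m
      {a b} : Fin k
      edge  : T (E i a j b)
      fromA : groupA x ≡ just i
      toB   : groupB y ≡ just j

  crossing-pre : ∀ {u x y} → Reachable u x → Crossing x y → Crossing u y
  crossing-pre (_ , w) (crossing e gx gy) = crossing e (walk-backward groupA-arc w gx) gy

  crossing-post : ∀ {x y v} → Crossing x y → Reachable y v → Crossing x v
  crossing-post (crossing e gx gy) (_ , w) = crossing e gx (walk-forward groupB-arc w gy)

  Covered : ∀ {x y} → List (V × V) → Crossing x y → Set
  Covered T c = (a¹ i , vA i a) ∈ T × (vB j b , b¹ j) ∈ T
    where open Crossing c

  data Shape (x y : V) : Set where
    crosses   : Crossing x y → Shape x y
    short     : ∀ {h} → h ≤ 1 → Walk Arc h x y → Shape x y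
    canonical : CanonicalEdge (x , y) → Shape x y

  crossing-at : ∀ {n i a j b x z y} → T (E i a j b) → groupA x ≡ just i → groupB z ≡ just j →
                Walk Arc n z y → Crossing x y
  crossing-at e gx gz w = crossing e gx (walk-forward groupB-arc w gz)

  shape : ∀ {n x y} → Walk Arc n x y → Shape x y
  shape nil                                                       = short z≤n nil
  shape (cons (pDirect _ e) w)                                    = crosses (crossing-at e refl refl w)
  shape (cons (pStart e _ _) w)                                   = crosses (crossing-at e refl refl w)
  shape (cons (pMid e _ _ _) w)                                   = crosses (crossing-at e refl refl w)
  shape (cons (pEnd e _ _) w)                                     = crosses (crossing-at e refl refl w)
  shape w@(cons _ nil)                                            = short ≤-refl w
  shape (cons (a¹a² i) (cons (a²A i a) nil))                      = canonical (canA i a)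
  shape (cons (a¹a² _) (cons (a²A _ _) (cons (pDirect _ e) w)))   = crosses (crossing-at e refl refl w)
  shape (cons (a¹a² _) (cons (a²A _ _) (cons (pStart e _ _) w)))  = crosses (crossing-at e refl refl w)
  shape (cons (a²A _ _) (cons (pDirect _ e) w))                   = crosses (crossing-at e refl refl w)
  shape (cons (a²A _ _) (cons (pStart e _ _) w))                  = crosses (crossing-at e refl refl w)
  shape (cons (Bb² j b) (cons (b²b¹ j) nil))                      = canonical (canB j b)
  shape (cons (Bb² _ _) (cons (b²b¹ _) (cons () _)))
  shape (cons (b²b¹ _) (cons () _))

  path-tail : ∀ {i a j b} (e : T (E i a j b)) (t : Fin (β ∸ 3)) (r : ℕ) →
              suc (toℕ t) + r ≡ β ∸ 3 → Walk Arc (suc r) (vE i a j b e t) (vB j b)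
  path-tail e t zero    p = cons (pEnd e t (trans (sym (+-identityʳ _)) p)) nil
  path-tail e t (suc r) p = cons (pMid e t t' (toℕ-fromℕ< t<)) (path-tail e t' r p')
    where
    t< : suc (toℕ t) < β ∸ 3
    t< = <-≤-trans (m<m+n (suc (toℕ t)) z<s) (≤-reflexive p)
    t' : Fin (β ∸ 3)
    t' = fromℕ< t<
    p' : suc (toℕ t') + r ≡ β ∸ 3
    p' = trans (cong (λ s → suc s + r) (toℕ-fromℕ< t<)) (trans (sym (+-suc (suc (toℕ t)) r)) p)

  edge-path : ∀ {i a j b} → T (E i a j b) → Walk Arc (suc (β ∸ 3)) (vA i a) (vB j b)
  edge-path e with β ∸ 3 in eq
  ... | zero  = cons (pDirect eq e) nil
  ... | suc r = cons (pStart e t₀ (toℕ-fromℕ< 0<)) (path-tail e t₀ r p)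
    where
    0< : 0 < β ∸ 3
    0< = subst (0 <_) (sym eq) z<s
    t₀ : Fin (β ∸ 3)
    t₀ = fromℕ< 0<
    p : suc (toℕ t₀) + r ≡ β ∸ 3
    p = trans (cong (λ s → suc s + r) (toℕ-fromℕ< 0<)) (sym eq)

  enter : ∀ {T i a x} → groupA x ≡ just i → level x ≤ 1 → (a¹ i , vA i a) ∈ T →
          WithShortcuts T x (vA i a)
  enter {x = a¹ _}           refl _           a∈T = inj₂ a∈T
  enter {x = a² _}           refl _           _   = inj₁ (a²A _ _)
  enter {x = vA _ _}         refl (s≤s ())    _
  enter {x = vE _ _ _ _ _ _} refl (s≤s ())    _
  enter {x = vB _ _}         ()   _           _
  enter {x = b² _}           ()   _           _
  enter {x = b¹ _}           ()   _           _

  leave : ∀ {T j b y} → groupB y ≡ just j → 4 + (β ∸ 3) ≤ level y → (vB j b , b¹ j) ∈ T →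
          WithShortcuts T (vB j b) y
  leave {y = b² _}           refl _    _   = inj₁ (Bb² _ _)
  leave {y = b¹ _}           refl _    b∈T = inj₂ b∈T
  leave {y = vB _ _}         refl high _   = ⊥-elim (1+n≰n high)
  leave {y = vE _ _ _ _ _ t} refl high _   =
    ⊥-elim (<-asym (toℕ<n t) (+-cancelˡ-≤ 3 _ _ high))
  leave {y = a¹ _}           ()   _    _
  leave {y = a² _}           ()   _    _
  leave {y = vA _ _}         ()   _    _

  crossing-route : ∀ {T x y} → 3 ≤ β → (c : Crossing x y) → Covered T c →
                   level x ≤ 1 → 4 + (β ∸ 3) ≤ level y → Hops T β x y
  crossing-route 3≤β c (a∈T , b∈T) x-low y-high =
    _ , ≤-reflexive hops≡β ,
    cons (enter fromA x-low a∈T) (liftᵂ (edge-path edge) ++ᵂ cons (leave toB y-high b∈T) nil)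
    where
    open Crossing c
    hops≡β : suc (suc (β ∸ 3) + 1) ≡ β
    hops≡β = trans (cong suc (+-comm (suc (β ∸ 3)) 1)) (m+[n∸m]≡n 3≤β)

  Code : Set
  Code = (Fin m × Fin k) ⊎ (Fin m × Fin k)

  _≟ᶜ_ : DecidableEquality Code
  _≟ᶜ_ = Sum.≡-dec (Product.≡-dec Fin._≟_ Fin._≟_) (Product.≡-dec Fin._≟_ Fin._≟_)

  decode : Code → V × V
  decode (inj₁ (i , a)) = a¹ i , vA i a
  decode (inj₂ (j , b)) = vB j b , b¹ j

  decode-injective : ∀ {c c'} → decode c ≡ decode c' → c ≡ c'
  decode-injective {inj₁ (_ , _)} {inj₁ (_ , _)} refl = refl
  decode-injective {inj₂ (_ , _)} {inj₂ (_ , _)} refl = refl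
  decode-injective {inj₁ (_ , _)} {inj₂ (_ , _)} ()
  decode-injective {inj₂ (_ , _)} {inj₁ (_ , _)} ()

  decode-canonical : ∀ c → CanonicalEdge (decode c)
  decode-canonical (inj₁ (i , a)) = canA i a
  decode-canonical (inj₂ (j , b)) = canB j b

  decode-reachable : ∀ c → uncurry Reachable (decode c)
  decode-reachable (inj₁ (i , a)) = 2 , cons (a¹a² i) (cons (a²A i a) nil)
  decode-reachable (inj₂ (j , b)) = 2 , cons (Bb² j b) (cons (b²b¹ j) nil)

  encode : ∀ {p} → CanonicalEdge p → Code
  encode (canA i a) = inj₁ (i , a)
  encode (canB j b) = inj₂ (j , b)

  decode-encode : ∀ {p} (e : CanonicalEdge p) → decode (encode e) ≡ p
  decode-encode (canA _ _) = refl
  decode-encode (canB _ _) = refl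

  codes : ∀ {x y} → Shape x y → List Code
  codes (crosses c)   = inj₁ (i , a) ∷ inj₂ (j , b) ∷ [] where open Crossing c
  codes (short _ _)   = []
  codes (canonical e) = encode e ∷ []

  codes-length : ∀ {x y} (s : Shape x y) → length (codes s) ≤ 2
  codes-length (crosses _)   = ≤-refl
  codes-length (short _ _)   = z≤n
  codes-length (canonical _) = s≤s z≤n

  shortcut-codes : ∀ {L} → All (uncurry Reachable) L → List Code
  shortcut-codes []       = []
  shortcut-codes (r ∷ rs) = codes (shape (proj₂ r)) ++ shortcut-codes rs

  shortcut-codes-length : ∀ {L} (rs : All (uncurry Reachable) L) →
                          length (shortcut-codes rs) ≤ 2 * length L
  shortcut-codes-length []                 = z≤n
  shortcut-codes-length {_ ∷ L} (r ∷ rs) = begin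
    length (codes s ++ shortcut-codes rs)            ≡⟨ length-++ (codes s) ⟩
    length (codes s) + length (shortcut-codes rs)    ≤⟨ +-mono-≤ (codes-length s) (shortcut-codes-length rs) ⟩
    2 + 2 * length L                                 ≡⟨ *-suc 2 (length L) ⟨
    2 * suc (length L)                               ∎
    where
    open ≤-Reasoning
    s = shape (proj₂ r)

  shortcut-codes-∈ : ∀ {L p c} (rs : All (uncurry Reachable) L) (p∈L : p ∈ L) →
                     c ∈ codes (shape (proj₂ (lookup rs p∈L))) → c ∈ shortcut-codes rs
  shortcut-codes-∈ (r ∷ rs) (here refl) c∈ = ∈-++⁺ˡ c∈
  shortcut-codes-∈ (r ∷ rs) (there p∈L) c∈ = ∈-++⁺ʳ _ (shortcut-codes-∈ rs p∈L c∈)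

module Canonicalisation (β m k : ℕ) (E : MinRepEdges m k)
  (S : List (Construction.V β m k E × Construction.V β m k E))
  (reachable : All (uncurry (Construction.Reachable β m k E)) S) where
  open Construction β m k E
  open Reduction β m k E

  canonical-codes : List Code
  canonical-codes = deduplicate _≟ᶜ_ (shortcut-codes reachable)

  S' : List (V × V)
  S' = map decode canonical-codes

  S'-unique : Unique S'
  S'-unique = Unique.map⁺ decode-injective (UniqueDec.deduplicate-! _≟ᶜ_ _)

  S'-canonical : IsCanonical S'
  S'-canonical = All.map⁺ (universal decode-canonical canonical-codes)

  S'-reachable : All (uncurry Reachable) S'
  S'-reachable = All.map⁺ (universal decode-reachable canonical-codes)

  S'-length : length S' ≤ 2 * length S
  S'-length = begin
    length S'                          ≡⟨ length-map decode canonical-codes ⟩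
    length canonical-codes             ≤⟨ length-deduplicate _≟ᶜ_ (shortcut-codes reachable) ⟩
    length (shortcut-codes reachable)  ≤⟨ shortcut-codes-length reachable ⟩
    2 * length S                       ∎
    where open ≤-Reasoning

  Certified : V → V → Set
  Certified x y = Σ (Crossing x y) (Covered S')

  replacement : ∀ {x y} (s : Shape x y) → (∀ {c} → c ∈ codes s → c ∈ canonical-codes) →
                Certified x y ⊎ Hops S' 1 x y
  replacement (crosses c) sub =
    inj₁ (c , ∈-map⁺ decode (sub (here refl)) , ∈-map⁺ decode (sub (there (here refl))))
  replacement (short h≤1 w) _ = inj₂ (_ , h≤1 , liftᵂ w)
  replacement (canonical e) sub =
    inj₂ (1 , ≤-refl , cons (inj₂ (subst (_∈ S') (decode-encode e) (∈-map⁺ decode (sub (here refl))))) nil)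

  hop-reachable : ∀ {x y} → WithShortcuts S x y → Reachable x y
  hop-reachable (inj₁ arc) = 1 , cons arc nil
  hop-reachable (inj₂ p∈S) = lookup reachable p∈S

  hop-replacement : ∀ {x y} → WithShortcuts S x y → Certified x y ⊎ Hops S' 1 x y
  hop-replacement (inj₁ arc) = inj₂ (1 , ≤-refl , cons (inj₁ arc) nil)
  hop-replacement (inj₂ p∈S) =
    replacement (shape (proj₂ (lookup reachable p∈S)))
                (λ c∈ → ∈-deduplicate⁺ _≟ᶜ_ (shortcut-codes-∈ reachable p∈S c∈))

  summarise : ∀ {n x y} → Walk (WithShortcuts S) n x y → Certified x y ⊎ Hops S' n x y
  summarise nil = inj₂ (0 , z≤n , nil)
  summarise (cons hop w) with hop-replacement hop | summarise w
  ... | inj₁ (c , cov) | _ = inj₁ (crossing-post c (reachable-walk hop-reachable w) , cov)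
  ... | inj₂ _ | inj₁ (c , cov) = inj₁ (crossing-pre (hop-reachable hop) c , cov)
  ... | inj₂ (h , h≤1 , p) | inj₂ (h' , h'≤n , q) = inj₂ (h + h' , +-mono-≤ h≤1 h'≤n , p ++ᵂ q)

  S'-hopbound : 3 ≤ β → (∀ x y → Reachable x y → Hops S β x y) →
                ∀ x y → Reachable x y → Hops S' β x y
  S'-hopbound 3≤β hopbound x y (n , w) with n ≤? β
  ... | yes n≤β = n , n≤β , liftᵂ w
  ... | no n≰β with hopbound x y (n , w)
  ...   | h , h≤β , w' with summarise w'
  ...     | inj₂ (h' , h'≤h , w'') = h' , ≤-trans h'≤h h≤β , w''
  ...     | inj₁ (c , cov) = uncurry (crossing-route 3≤β c cov) (long-walk-ends 3≤β w (≰⇒> n≰β))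

lemma52 : (β m k : ℕ) (E : MinRepEdges m k) → 3 ≤ β →
    (S : List (Construction.V β m k E × Construction.V β m k E)) →
    Unique S → Construction.IsShortcutSet β m k E S →
    ∃[ S' ] (Unique S' × Construction.IsShortcutSet β m k E S' ×
             Construction.IsCanonical β m k E S' × length S' ≤ 2 * length S)
lemma52 β m k E 3≤β S _ (reachable , hopbound) =
  S' , S'-unique , (S'-reachable , S'-hopbound 3≤β hopbound) , S'-canonical , S'-length
  where open Canonicalisation β m k E S reachable
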